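{- For every instance of the stable matching problem with one-sided uncertainty (with $|A|=|B|=n$), in the comparison query model, the minimum number of queries needed to verify that the $B$-optimal stable matching is stable and $B$-optimal (and thus also the minimum number needed to find the $B$-optimal stable matching) is at least $n-1$.
   Context: Two disjoint sets $A$, $B$ of agents with $|A|=|B|=n$. Each $a\in A$ has a strict total order $\prec_a$ on $B$ and each $b\in B$ has a strict total order $\prec_b$ on $A$ ($x\prec_y z$: $y$ prefers $x$ to $z$). A matching is a bijection between $A$ and $B$; it is stable if there is no pair $(a,b)$, $b\neq M(a)$, with $a$ preferring $b$ to $M(a)$ and $b$ preferring $a$ to $M(b)$. A stable matching is $B$-optimal if every agent of $B$ weakly prefers its partner in it to its partner in any other stable matching. One-sided uncertainty: the orders $\prec_a$ ($a\in A$) are known, the orders $\prec_b$ ($b\in B$) are unknown and learned only via queries. A comparison query $\mathit{prefer}(b,a_1,a_2)$ returns whichever of $a_1,a_2$ agent $b$ prefers. A query set verifies the property if, for every $B$-side preference profile consistent with the $A$-side preferences and the answers, the matching is stable and $B$-optimal. -}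

module Defs where

open import Level using (0ℓ)
open import Data.Nat using (ℕ)
open import Data.Fin using (Fin)
open import Data.Fin.Permutation using (Permutation′; _⟨$⟩ʳ_; _⟨$⟩ˡ_)
open import Data.Product using (Σ; _×_; _,_)
open import Data.Sum using (_⊎_)
open import Data.List using (List)
open import Data.List.Membership.Propositional using (_∈_)
open import Data.List.Relation.Unary.All using (All)
open import Relation.Binary using (Rel; IsStrictTotalOrder)
open import Relation.Binary.PropositionalEquality using (_≡_)
open import Relation.Nullary using (¬_)
open import Function.Bundles using (_⇔_)

-- Agents of A and of B are both indexed by Fin n.
-- A preference order of one agent over the other side: a strict total order
-- (x ≺ z : the agent prefers x to z).
record PrefOrder (n : ℕ) : Set₁ where
  field
    _≺_ : Rel (Fin n) 0ℓ
    isSTO : IsStrictTotalOrder _≡_ _≺_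
open PrefOrder public

Profile : ℕ → Set₁
Profile n = Fin n → PrefOrder n

-- pA a : preferences of a ∈ A over B;  pB b : preferences of b ∈ B over A.
-- A matching is a bijection A → B; M ⟨$⟩ʳ a = M(a), M ⟨$⟩ˡ b = M(b).
Matching : ℕ → Set
Matching n = Permutation′ n

Stable : ∀ {n} → Profile n → Profile n → Matching n → Set
Stable {n} pA pB M =
  (a b : Fin n) → ¬ (b ≡ M ⟨$⟩ʳ a) →
    ¬ ((_≺_ (pA a) b (M ⟨$⟩ʳ a)) × (_≺_ (pB b) a (M ⟨$⟩ˡ b)))

BOptimal : ∀ {n} → Profile n → Profile n → Matching n → Set
BOptimal {n} pA pB M =
  (M' : Matching n) → Stable pA pB M' →
    (b : Fin n) → (M ⟨$⟩ˡ b ≡ M' ⟨$⟩ˡ b) ⊎ (_≺_ (pB b) (M ⟨$⟩ˡ b) (M' ⟨$⟩ˡ b))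

-- A comparison query prefer(b, a₁, a₂) is represented as the triple (b , a₁ , a₂).
Query : ℕ → Set
Query n = Fin n × Fin n × Fin n

-- A profile pB' is consistent with the answers that the true profile pB gives
-- to the queries in Q iff every query gets the same answer under pB' as under pB
-- (for a₁ ≠ a₂ the answer is a₁ exactly when b prefers a₁ to a₂).
ConsistentAnswers : ∀ {n} → List (Query n) → Profile n → Profile n → Set
ConsistentAnswers Q pB pB' =
  All (λ { (b , a₁ , a₂) → _≺_ (pB b) a₁ a₂ ⇔ _≺_ (pB' b) a₁ a₂ }) Q

Verifies : ∀ {n} → Profile n → Profile n → Matching n → List (Query n) → Set₁
Verifies {n} pA pB M Q =
  (pB' : Profile n) → ConsistentAnswers Q pB pB' →
    Stable pA pB' M × BOptimal pA pB' M

module Submission where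

-- If two agents b₁ ≠ b₂ of B are never queried, their preferences can be changed
-- without affecting any answer. Let a₁ be the partner of b₁ in M, and let b₁ rank
-- a₁ last and b₂ rank a₁ first. Verification forces M to stay stable, and then a
-- break-marriage chain (a₁ leaves b₁ and proposes down its list; every displaced
-- agent of A does the same; b₁ accepts the first newcomer) reaches another stable
-- matching, in which b₁ is better off than with a₁: M is not B-optimal. So at most
-- one agent of B is unqueried, and at least n − 1 queries are needed.

open import Defs
open import Data.Nat using (ℕ; _≤_; _∸_)
open import Data.List using (List; length)
open import Data.Product using (_×_)

open import Data.Nat using (zero; suc; _*_; _<_; _≤?_; z≤n; s≤s)
import Data.Nat.Properties as ℕ
open import Data.Nat.Induction using (<-wellFounded)
open import Data.Nat.ListAction using (sum)
open import Induction.WellFounded using (Acc; acc)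
open import Data.Fin using (Fin; toℕ; _≟_)
open import Data.Fin.Properties using (toℕ<n; toℕ-injective; pigeonhole; ¬∀⟶∃¬; <⇒≢)
open import Data.Fin.Permutation using (_⟨$⟩ʳ_; _⟨$⟩ˡ_; inverseˡ; inverseʳ; _∘ₚ_; transpose)
import Data.Fin.Permutation.Components as PC
open import Data.Product using (∃; _,_; proj₁; proj₂)
open import Data.Sum using (_⊎_; inj₁; inj₂)
open import Data.Empty using (⊥-elim)
open import Data.List using ([]; _∷_; map; filter; allFin; lookup)
open import Data.List.Properties using (length-tabulate; length-filter; length-map)
open import Data.List.Membership.Propositional using (_∈_; _∉_)
open import Data.List.Membership.Propositional.Properties using (∈-allFin; ∈-map⁺)
import Data.List.Membership.DecPropositional as DecMembership
open import Data.List.Relation.Unary.Any using (here; there; index)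
open import Data.List.Relation.Unary.Any.Properties using (lookup-index)
open import Data.List.Relation.Unary.All as All using ()
open import Relation.Binary using (IsStrictTotalOrder; Tri; tri<; tri≈; tri>)
open import Relation.Binary.PropositionalEquality
  using (_≡_; _≢_; refl; sym; trans; cong; subst; subst₂; isEquivalence; resp₂; module ≡-Reasoning)
open import Relation.Nullary using (¬_; Dec; yes; no; ¬?)
open import Relation.Nullary.Decidable using (_×-dec_; _⊎-dec_)
open import Relation.Unary using (Pred; Decidable)
open import Function.Base using (id; _∘_)
open import Function.Bundles using (_⇔_; mk⇔)
open import Function.Definitions using (Injective)
open import Level using (0ℓ)

infix 4 _≺⟨_⟩_ _≼⟨_⟩_

_≺⟨_⟩_ : ∀ {n} → Fin n → PrefOrder n → Fin n → Set
x ≺⟨ p ⟩ y = _≺_ p x y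

_≼⟨_⟩_ : ∀ {n} → Fin n → PrefOrder n → Fin n → Set
x ≼⟨ p ⟩ y = x ≺⟨ p ⟩ y ⊎ x ≡ y

module Pref {n : ℕ} (p : PrefOrder n) where
  open IsStrictTotalOrder (isSTO p) public
    using (compare; _<?_) renaming (asym to ≺-asym; trans to ≺-trans)

  ≺-irrefl : ∀ {x} → ¬ x ≺⟨ p ⟩ x
  ≺-irrefl = IsStrictTotalOrder.irrefl (isSTO p) refl

  ≺⇒≢ : ∀ {x y} → x ≺⟨ p ⟩ y → x ≢ y
  ≺⇒≢ x≺x refl = ≺-irrefl x≺x

  ≮⇒≽ : ∀ {x y} → ¬ x ≺⟨ p ⟩ y → y ≼⟨ p ⟩ x
  ≮⇒≽ {x} {y} x≮y with compare x y
  ... | tri< x≺y _ _ = ⊥-elim (x≮y x≺y)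
  ... | tri≈ _ x≡y _ = inj₂ (sym x≡y)
  ... | tri> _ _ y≺x = inj₁ y≺x

  ≺-≼-asym : ∀ {x y} → x ≺⟨ p ⟩ y → ¬ y ≼⟨ p ⟩ x
  ≺-≼-asym x≺y (inj₁ y≺x) = ≺-asym x≺y y≺x
  ≺-≼-asym x≺y (inj₂ refl) = ≺-irrefl x≺y

  ≺-or-≽ : ∀ x y → x ≺⟨ p ⟩ y ⊎ y ≼⟨ p ⟩ x
  ≺-or-≽ x y with x <? y
  ... | yes x≺y = inj₁ x≺y
  ... | no x≮y = inj₂ (≮⇒≽ x≮y)

  rank : Fin n → ℕ
  rank x = length (filter (_<? x) (allFin n))

  ≺-≼-trans : ∀ {x y z} → x ≺⟨ p ⟩ y → y ≼⟨ p ⟩ z → x ≺⟨ p ⟩ z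
  ≺-≼-trans x≺y (inj₁ y≺z) = ≺-trans x≺y y≺z
  ≺-≼-trans x≺y (inj₂ refl) = x≺y

  module _ {P : Pred (Fin n) 0ℓ} (P? : Decidable P) where

    LeastIn : List (Fin n) → Fin n → Set
    LeastIn xs m = P m × (∀ y → y ∈ xs → P y → m ≼⟨ p ⟩ y)

    minimumIn : ∀ xs → (∀ y → y ∈ xs → ¬ P y) ⊎ ∃ (LeastIn xs)
    minimumIn [] = inj₁ λ _ ()
    minimumIn (x ∷ xs) with P? x | minimumIn xs
    ... | no ¬Px | inj₁ none = inj₁ λ { y (here refl) → ¬Px ; y (there y∈) → none y y∈ }
    ... | no ¬Px | inj₂ (m , Pm , least) =
      inj₂ (m , Pm , λ { y (here refl) Py → ⊥-elim (¬Px Py) ; y (there y∈) → least y y∈ })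
    ... | yes Px | inj₁ none =
      inj₂ (x , Px , λ { y (here refl) _ → inj₂ refl ; y (there y∈) Py → ⊥-elim (none y y∈ Py) })
    ... | yes Px | inj₂ (m , Pm , least) with ≺-or-≽ x m
    ...   | inj₁ x≺m = inj₂ (x , Px , λ { y (here refl) _ → inj₂ refl
                                          ; y (there y∈) Py → inj₁ (≺-≼-trans x≺m (least y y∈ Py)) })
    ...   | inj₂ m≼x = inj₂ (m , Pm , λ { y (here refl) _ → m≼x ; y (there y∈) → least y y∈ })

    minimum : (∀ y → ¬ P y) ⊎ ∃ λ m → P m × (∀ y → P y → m ≼⟨ p ⟩ y)
    minimum with minimumIn (allFin n)
    ... | inj₁ none = inj₁ λ y → none y (∈-allFin y)
    ... | inj₂ (m , Pm , least) = inj₂ (m , Pm , λ y → least y (∈-allFin y))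

module _ {A : Set} {P Q : Pred A 0ℓ} (P? : Decidable P) (Q? : Decidable Q)
         (P⇒Q : ∀ {x} → P x → Q x) where

  length-filter-mono : ∀ xs → length (filter P? xs) ≤ length (filter Q? xs)
  length-filter-mono [] = z≤n
  length-filter-mono (x ∷ xs) with P? x | Q? x
  ... | yes _ | yes _ = s≤s (length-filter-mono xs)
  ... | yes Px | no ¬Qx = ⊥-elim (¬Qx (P⇒Q Px))
  ... | no _ | yes _ = ℕ.m≤n⇒m≤1+n (length-filter-mono xs)
  ... | no _ | no _ = length-filter-mono xs

  length-filter-mono-< : ∀ {x} xs → x ∈ xs → Q x → ¬ P x →
                         length (filter P? xs) < length (filter Q? xs)
  length-filter-mono-< (y ∷ xs) (here refl) Qy ¬Py with P? y | Q? y
  ... | yes Py | _ = ⊥-elim (¬Py Py)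
  ... | no _ | yes _ = s≤s (length-filter-mono xs)
  ... | no _ | no ¬Qy = ⊥-elim (¬Qy Qy)
  length-filter-mono-< (y ∷ xs) (there x∈) Qx ¬Px with P? y | Q? y
  ... | yes _ | yes _ = s≤s (length-filter-mono-< xs x∈ Qx ¬Px)
  ... | yes Py | no ¬Qy = ⊥-elim (¬Qy (P⇒Q Py))
  ... | no _ | yes _ = ℕ.m≤n⇒m≤1+n (length-filter-mono-< xs x∈ Qx ¬Px)
  ... | no _ | no _ = length-filter-mono-< xs x∈ Qx ¬Px

rank-mono : ∀ {n} (p : PrefOrder n) {x y} → x ≺⟨ p ⟩ y → Pref.rank p x < Pref.rank p y
rank-mono {n} p {x} {y} x≺y =
  length-filter-mono-< (λ z → Pref._<?_ p z x) (λ z → Pref._<?_ p z y)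
    (λ z≺x → Pref.≺-trans p z≺x x≺y) (allFin n) (∈-allFin _) x≺y (Pref.≺-irrefl p)

rank≤n : ∀ {n} (p : PrefOrder n) x → Pref.rank p x ≤ n
rank≤n {n} p x = subst (Pref.rank p x ≤_) (length-tabulate id) (length-filter _ (allFin n))

module _ {A : Set} (g h : A → ℕ) (g≤h : ∀ x → g x ≤ h x) where

  sum-map-mono : ∀ xs → sum (map g xs) ≤ sum (map h xs)
  sum-map-mono [] = z≤n
  sum-map-mono (x ∷ xs) = ℕ.+-mono-≤ (g≤h x) (sum-map-mono xs)

  sum-map-mono-< : ∀ {x} xs → x ∈ xs → g x < h x → sum (map g xs) < sum (map h xs)
  sum-map-mono-< (_ ∷ xs) (here refl) gx<hx = ℕ.+-mono-<-≤ gx<hx (sum-map-mono xs)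
  sum-map-mono-< (y ∷ xs) (there x∈) gx<hx = ℕ.+-mono-≤-< (g≤h y) (sum-map-mono-< xs x∈ gx<hx)

sum-map-≤ : ∀ {A : Set} (g : A → ℕ) {k} → (∀ x → g x ≤ k) →
            ∀ xs → sum (map g xs) ≤ length xs * k
sum-map-≤ g g≤k [] = z≤n
sum-map-≤ g g≤k (x ∷ xs) = ℕ.+-mono-≤ (g≤k x) (sum-map-≤ g g≤k xs)

length<n⇒∃∉ : ∀ {n} (xs : List (Fin n)) → length xs < n → ∃ λ x → x ∉ xs
length<n⇒∃∉ {n} xs |xs|<n = ¬∀⟶∃¬ n (_∈ xs) (_∈? xs) ¬all∈
  where
  open DecMembership (_≟_ {n}) using (_∈?_)
  ¬all∈ : ¬ (∀ x → x ∈ xs)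
  ¬all∈ all∈ with pigeonhole |xs|<n (λ x → index (all∈ x))
  ... | i , j , i<j , same-index = <⇒≢ i<j (begin
    i                             ≡⟨ lookup-index (all∈ i) ⟩
    lookup xs (index (all∈ i))    ≡⟨ cong (lookup xs) same-index ⟩
    lookup xs (index (all∈ j))    ≡⟨ lookup-index (all∈ j) ⟨
    j                             ∎)
    where open ≡-Reasoning

length-of-all-but-one : ∀ {n} (xs : List (Fin n)) → (∀ {x y} → x ∉ xs → y ∉ xs → x ≡ y) →
                        n ∸ 1 ≤ length xs
length-of-all-but-one {zero} xs _ = z≤n
length-of-all-but-one {suc n} xs unique with n ≤? length xs
... | yes n≤|xs| = n≤|xs|
... | no n≰|xs| with length<n⇒∃∉ xs (ℕ.m<n⇒m<1+n (ℕ.≰⇒> n≰|xs|))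
...   | x , x∉xs with length<n⇒∃∉ (x ∷ xs) (s≤s (ℕ.≰⇒> n≰|xs|))
...     | y , y∉x∷xs = ⊥-elim (y∉x∷xs (here (unique (λ y∈ → y∉x∷xs (there y∈)) x∉xs)))

keyOrder : ∀ {n} (k : Fin n → ℕ) → Injective _≡_ _≡_ k → PrefOrder n
keyOrder k k-injective = record
  { _≺_ = λ x y → k x < k y
  ; isSTO = record
    { isStrictPartialOrder = record
      { isEquivalence = isEquivalence
      ; irrefl = λ { refl → ℕ.<-irrefl refl }
      ; trans = ℕ.<-trans
      ; <-resp-≈ = resp₂ _
      }
    ; compare = compare
    }
  }
  where
  compare : ∀ x y → Tri (k x < k y) (x ≡ y) (k y < k x)
  compare x y with ℕ.<-cmp (k x) (k y)
  ... | tri< lt ne gt = tri< lt (λ x≡y → ne (cong k x≡y)) gt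
  ... | tri≈ lt eq gt = tri≈ lt (k-injective eq) gt
  ... | tri> lt ne gt = tri> lt (λ x≡y → ne (cong k x≡y)) gt

module _ {n : ℕ} (a : Fin n) where
  private
    lastKey : Fin n → ℕ
    lastKey x with x ≟ a
    ... | yes _ = n
    ... | no _ = toℕ x

    lastKey-injective : Injective _≡_ _≡_ lastKey
    lastKey-injective {x} {y} eq with x ≟ a | y ≟ a
    ... | yes refl | yes refl = refl
    ... | yes _ | no _ = ⊥-elim (ℕ.<-irrefl (sym eq) (toℕ<n y))
    ... | no _ | yes _ = ⊥-elim (ℕ.<-irrefl eq (toℕ<n x))
    ... | no _ | no _ = toℕ-injective eq

    firstKey : Fin n → ℕ
    firstKey x with x ≟ a
    ... | yes _ = zero
    ... | no _ = suc (toℕ x)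

    firstKey-injective : Injective _≡_ _≡_ firstKey
    firstKey-injective {x} {y} eq with x ≟ a | y ≟ a | eq
    ... | yes refl | yes refl | _ = refl
    ... | yes _ | no _ | ()
    ... | no _ | yes _ | ()
    ... | no _ | no _ | eq′ = toℕ-injective (ℕ.suc-injective eq′)

  putLast : PrefOrder n
  putLast = keyOrder lastKey lastKey-injective

  putFirst : PrefOrder n
  putFirst = keyOrder firstKey firstKey-injective

  putLast-last : ∀ x → x ≢ a → x ≺⟨ putLast ⟩ a
  putLast-last x x≢a with x ≟ a | a ≟ a
  ... | yes x≡a | _ = ⊥-elim (x≢a x≡a)
  ... | no _ | yes _ = toℕ<n x
  ... | no _ | no a≢a = ⊥-elim (a≢a refl)

  putFirst-first : ∀ x → x ≢ a → a ≺⟨ putFirst ⟩ x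
  putFirst-first x x≢a with x ≟ a | a ≟ a
  ... | yes x≡a | _ = ⊥-elim (x≢a x≡a)
  ... | no _ | yes _ = s≤s z≤n
  ... | no _ | no a≢a = ⊥-elim (a≢a refl)

_[_≔_] : ∀ {n} → Profile n → Fin n → PrefOrder n → Profile n
(p [ b ≔ o ]) x with x ≟ b
... | yes _ = o
... | no _ = p x

update-≡ : ∀ {n} (p : Profile n) b o → (p [ b ≔ o ]) b ≡ o
update-≡ p b o with b ≟ b
... | yes _ = refl
... | no b≢b = ⊥-elim (b≢b refl)

update-≢ : ∀ {n} (p : Profile n) b o x → x ≢ b → (p [ b ≔ o ]) x ≡ p x
update-≢ p b o x x≢b with x ≟ b
... | yes x≡b = ⊥-elim (x≢b x≡b)
... | no _ = refl

queried : ∀ {n} → List (Query n) → List (Fin n)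
queried = map proj₁

agree⇒consistent : ∀ {n} (Q : List (Query n)) {pB pB′ : Profile n} →
                   (∀ b → b ∈ queried Q → pB′ b ≡ pB b) → ConsistentAnswers Q pB pB′
agree⇒consistent Q {pB} agree = All.tabulate λ { {b , x , y} q∈Q →
  subst (λ o → x ≺⟨ pB b ⟩ y ⇔ x ≺⟨ o ⟩ y) (sym (agree b (∈-map⁺ proj₁ q∈Q)))
    (mk⇔ id id) }

module _ {n : ℕ} (μ : Matching n) where

  ⟨$⟩ʳ-injective : Injective _≡_ _≡_ (μ ⟨$⟩ʳ_)
  ⟨$⟩ʳ-injective {x} {y} eq = trans (sym (inverseˡ μ)) (trans (cong (μ ⟨$⟩ˡ_) eq) (inverseˡ μ))

  ʳ⇒ˡ : ∀ {a b} → μ ⟨$⟩ʳ a ≡ b → μ ⟨$⟩ˡ b ≡ a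
  ʳ⇒ˡ refl = inverseˡ μ

  ˡ⇒ʳ : ∀ {a b} → μ ⟨$⟩ˡ b ≡ a → μ ⟨$⟩ʳ a ≡ b
  ˡ⇒ʳ refl = inverseʳ μ

stable⇒prefers-partner : ∀ {n} (pA pB : Profile n) (μ : Matching n) → Stable pA pB μ →
  ∀ {a b} → b ≺⟨ pA a ⟩ μ ⟨$⟩ʳ a → μ ⟨$⟩ˡ b ≺⟨ pB b ⟩ a
stable⇒prefers-partner pA pB μ stable {a} {b} b≺μa
  with Pref.≮⇒≽ (pB b) (λ a≺μb → stable a b (Pref.≺⇒≢ (pA a) b≺μa) (b≺μa , a≺μb))
... | inj₁ μb≺a = μb≺a
... | inj₂ μb≡a = ⊥-elim (Pref.≺⇒≢ (pA a) b≺μa (sym (ˡ⇒ʳ μ μb≡a)))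

module _ {n : ℕ} (i j : Fin n) where

  transpose-≡ˡ : PC.transpose i j i ≡ j
  transpose-≡ˡ with i ≟ i
  ... | yes _ = refl
  ... | no i≢i = ⊥-elim (i≢i refl)

  transpose-≡ʳ : i ≢ j → PC.transpose i j j ≡ i
  transpose-≡ʳ i≢j with j ≟ i
  ... | yes j≡i = ⊥-elim (i≢j (sym j≡i))
  ... | no _ with j ≟ j
  ...   | yes _ = refl
  ...   | no j≢j = ⊥-elim (j≢j refl)

  transpose-≢ : ∀ {k} → k ≢ i → k ≢ j → PC.transpose i j k ≡ k
  transpose-≢ {k} k≢i k≢j with k ≟ i
  ... | yes k≡i = ⊥-elim (k≢i k≡i)
  ... | no _ with k ≟ j
  ...   | yes k≡j = ⊥-elim (k≢j k≡j)
  ...   | no _ = refl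

module BreakMarriage {n : ℕ} (pA pB : Profile n) (M : Matching n) (M-stable : Stable pA pB M)
  (b₁ b₂ : Fin n) (b₁≢b₂ : b₁ ≢ b₂)
  (a₁-last : ∀ a → a ≢ M ⟨$⟩ˡ b₁ → a ≺⟨ pB b₁ ⟩ M ⟨$⟩ˡ b₁)
  (a₁-first : ∀ a → a ≢ M ⟨$⟩ˡ b₁ → M ⟨$⟩ˡ b₁ ≺⟨ pB b₂ ⟩ a) where

  a₁ : Fin n
  a₁ = M ⟨$⟩ˡ b₁

  M-a₁ : M ⟨$⟩ʳ a₁ ≡ b₁
  M-a₁ = inverseʳ M

  a₁-unwanted : ∀ a → ¬ a₁ ≺⟨ pB b₁ ⟩ a
  a₁-unwanted a a₁≺a with a ≟ a₁
  ... | yes refl = Pref.≺-irrefl (pB b₁) a₁≺a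
  ... | no a≢a₁ = Pref.≺-asym (pB b₁) a₁≺a (a₁-last a a≢a₁)

  b₁≺b₂ : b₁ ≺⟨ pA a₁ ⟩ b₂
  b₁≺b₂ with Pref.≮⇒≽ (pA a₁) b₂⊀b₁
    where
    Mb₂≢a₁ : M ⟨$⟩ˡ b₂ ≢ a₁
    Mb₂≢a₁ eq = b₁≢b₂ (trans (sym M-a₁) (ˡ⇒ʳ M eq))
    b₂⊀b₁ : ¬ b₂ ≺⟨ pA a₁ ⟩ b₁
    b₂⊀b₁ b₂≺b₁ = Pref.≺-asym (pB b₂)
      (stable⇒prefers-partner pA pB M M-stable (subst (b₂ ≺⟨ pA a₁ ⟩_) (sym M-a₁) b₂≺b₁))
      (a₁-first _ Mb₂≢a₁)
  ... | inj₁ b₁≺b₂ = b₁≺b₂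
  ... | inj₂ b₁≡b₂ = ⊥-elim (b₁≢b₂ b₁≡b₂)

  b₁-undesired-in-M : ∀ a → a ≢ a₁ → M ⟨$⟩ʳ a ≺⟨ pA a ⟩ b₁
  b₁-undesired-in-M a a≢a₁ with Pref.≮⇒≽ (pA a) b₁⊀Ma
    where
    b₁⊀Ma : ¬ b₁ ≺⟨ pA a ⟩ M ⟨$⟩ʳ a
    b₁⊀Ma b₁≺Ma = a₁-unwanted a (stable⇒prefers-partner pA pB M M-stable b₁≺Ma)
  ... | inj₁ Ma≺b₁ = Ma≺b₁
  ... | inj₂ Ma≡b₁ = ⊥-elim (a≢a₁ (sym (ʳ⇒ˡ M Ma≡b₁)))

  -- A state of the chain: f ∈ A has just left c and is parked on b₁ in μ; f
  -- proposes only to agents it ranks below c. The chain terminates because every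
  -- proposal moves some agent of A strictly down its list.
  record Invariant (μ : Matching n) (f c : Fin n) : Set where
    field
      f↦b₁ : μ ⟨$⟩ʳ f ≡ b₁
      b₁-undesired : ∀ a → a ≢ f → a ≢ a₁ → μ ⟨$⟩ʳ a ≺⟨ pA a ⟩ b₁
      c≺b₁ : f ≢ a₁ → c ≺⟨ pA f ⟩ b₁
      no-envy : ∀ a b → a ≢ f → b ≢ b₁ →
                b ≺⟨ pA a ⟩ μ ⟨$⟩ʳ a → μ ⟨$⟩ˡ b ≺⟨ pB b ⟩ a
      f-rejected : ∀ b → b ≢ b₁ → b ≼⟨ pA f ⟩ c → μ ⟨$⟩ˡ b ≺⟨ pB b ⟩ f
      a₁-above-b₂ : f ≢ a₁ → μ ⟨$⟩ʳ a₁ ≼⟨ pA a₁ ⟩ b₂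
      c-above-b₂ : f ≡ a₁ → c ≺⟨ pA a₁ ⟩ b₂

  -- b₁ accepts every proposer except a₁, whom it ranks last.
  Candidate : Matching n → Fin n → Fin n → Pred (Fin n) 0ℓ
  Candidate μ f c b =
    c ≺⟨ pA f ⟩ b × (b ≡ b₁ × f ≢ a₁ ⊎ b ≢ b₁ × f ≺⟨ pB b ⟩ μ ⟨$⟩ˡ b)

  Best : Matching n → Fin n → Fin n → Pred (Fin n) 0ℓ
  Best μ f c b = ∀ y → Candidate μ f c y → b ≼⟨ pA f ⟩ y

  candidate? : ∀ μ f c → Decidable (Candidate μ f c)
  candidate? μ f c b = Pref._<?_ (pA f) c b ×-dec
    ((b ≟ b₁ ×-dec ¬? (f ≟ a₁)) ⊎-dec (¬? (b ≟ b₁) ×-dec Pref._<?_ (pB b) f (μ ⟨$⟩ˡ b)))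

  module _ {μ : Matching n} {f c : Fin n} (inv : Invariant μ f c) where
    open Invariant inv

    b₁-candidate : f ≢ a₁ → Candidate μ f c b₁
    b₁-candidate f≢a₁ = c≺b₁ f≢a₁ , inj₁ (refl , f≢a₁)

    b₂-candidate : f ≡ a₁ → Candidate μ f c b₂
    b₂-candidate refl = c-above-b₂ refl , inj₂ (b₁≢b₂ ∘ sym , a₁-first _ μb₂≢a₁)
      where
      μb₂≢a₁ : μ ⟨$⟩ˡ b₂ ≢ a₁
      μb₂≢a₁ eq = b₁≢b₂ (trans (sym f↦b₁) (ˡ⇒ʳ μ eq))

    candidate-exists : ∃ (Candidate μ f c)
    candidate-exists with f ≟ a₁
    ... | yes f≡a₁ = b₂ , b₂-candidate f≡a₁
    ... | no f≢a₁ = b₁ , b₁-candidate f≢a₁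

    f-unblocked : Best μ f c b₁ →
                  ∀ {b} → b ≢ b₁ → b ≺⟨ pA f ⟩ b₁ → ¬ f ≺⟨ pB b ⟩ μ ⟨$⟩ˡ b
    f-unblocked b₁-best {b} b≢b₁ b≺b₁ f≺μb with Pref.≺-or-≽ (pA f) c b
    ... | inj₁ c≺b = Pref.≺-≼-asym (pA f) b≺b₁ (b₁-best b (c≺b , inj₂ (b≢b₁ , f≺μb)))
    ... | inj₂ b≼c = Pref.≺-asym (pB b) f≺μb (f-rejected b b≢b₁ b≼c)

    b₁-unblocked : ∀ {a} → a ≢ f →
                   b₁ ≺⟨ pA a ⟩ μ ⟨$⟩ʳ a → ¬ a ≺⟨ pB b₁ ⟩ μ ⟨$⟩ˡ b₁
    b₁-unblocked {a} a≢f b₁≺μa a≺μb₁ with a ≟ a₁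
    ... | yes refl = a₁-unwanted _ a≺μb₁
    ... | no a≢a₁ = Pref.≺-asym (pA a) b₁≺μa (b₁-undesired a a≢f a≢a₁)

    stable-if-b₁-best : Best μ f c b₁ → Stable pA pB μ
    stable-if-b₁-best b₁-best a b _ (b≺μa , a≺μb) with a ≟ f | b ≟ b₁
    ... | yes refl | yes refl = Pref.≺-irrefl (pA f) (subst (b₁ ≺⟨ pA f ⟩_) f↦b₁ b≺μa)
    ... | yes refl | no b≢b₁ =
      f-unblocked b₁-best b≢b₁ (subst (b ≺⟨ pA f ⟩_) f↦b₁ b≺μa) a≺μb
    ... | no a≢f | yes refl = b₁-unblocked a≢f b≺μa a≺μb
    ... | no a≢f | no b≢b₁ = Pref.≺-asym (pB b) a≺μb (no-envy a b a≢f b≢b₁ b≺μa)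

  position : Matching n → Fin n → Fin n → Fin n → Fin n
  position μ f c a with a ≟ f
  ... | yes _ = c
  ... | no _ = μ ⟨$⟩ʳ a

  position-free : ∀ μ f c → position μ f c f ≡ c
  position-free μ f c with f ≟ f
  ... | yes _ = refl
  ... | no f≢f = ⊥-elim (f≢f refl)

  position-other : ∀ μ f c {a} → a ≢ f → position μ f c a ≡ μ ⟨$⟩ʳ a
  position-other μ f c {a} a≢f with a ≟ f
  ... | yes a≡f = ⊥-elim (a≢f a≡f)
  ... | no _ = refl

  potential : Matching n → Fin n → Fin n → ℕ
  potential μ f c = sum (map (λ a → Pref.rank (pA a) (position μ f c a)) (allFin n))

  potential≤n² : ∀ μ f c → potential μ f c ≤ n * n
  potential≤n² μ f c = subst (λ m → potential μ f c ≤ m * n) (length-tabulate {n = n} id)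
    (sum-map-≤ _ (λ a → rank≤n (pA a) _) (allFin n))

  module Step {μ : Matching n} {f c : Fin n} (inv : Invariant μ f c)
              {b : Fin n} (b≢b₁ : b ≢ b₁) (c≺b : c ≺⟨ pA f ⟩ b)
              (f≺h : f ≺⟨ pB b ⟩ μ ⟨$⟩ˡ b)
              (b-best : Best μ f c b) where
    open Invariant inv

    h : Fin n
    h = μ ⟨$⟩ˡ b

    -- f marries b, and b's previous partner h takes over the placeholder b₁.
    μ′ : Matching n
    μ′ = μ ∘ₚ transpose b b₁

    μh : μ ⟨$⟩ʳ h ≡ b
    μh = inverseʳ μ

    h≢f : h ≢ f
    h≢f h≡f = b≢b₁ (trans (sym μh) (trans (cong (μ ⟨$⟩ʳ_) h≡f) f↦b₁))

    μ′-f : μ′ ⟨$⟩ʳ f ≡ b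
    μ′-f = trans (cong (PC.transpose b b₁) f↦b₁) (transpose-≡ʳ b b₁ b≢b₁)

    μ′-h : μ′ ⟨$⟩ʳ h ≡ b₁
    μ′-h = trans (cong (PC.transpose b b₁) μh) (transpose-≡ˡ b b₁)

    μ′-other : ∀ {a} → a ≢ f → a ≢ h → μ′ ⟨$⟩ʳ a ≡ μ ⟨$⟩ʳ a
    μ′-other a≢f a≢h = transpose-≢ b b₁
      (λ μa≡b → a≢h (sym (ʳ⇒ˡ μ μa≡b)))
      (λ μa≡b₁ → a≢f (⟨$⟩ʳ-injective μ (trans μa≡b₁ (sym f↦b₁))))

    μ′⁻¹-b : μ′ ⟨$⟩ˡ b ≡ f
    μ′⁻¹-b = trans (cong (μ ⟨$⟩ˡ_) (transpose-≡ʳ b₁ b (b≢b₁ ∘ sym))) (ʳ⇒ˡ μ f↦b₁)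

    μ′⁻¹-other : ∀ {y} → y ≢ b → y ≢ b₁ → μ′ ⟨$⟩ˡ y ≡ μ ⟨$⟩ˡ y
    μ′⁻¹-other y≢b y≢b₁ = cong (μ ⟨$⟩ˡ_) (transpose-≢ b₁ b y≢b₁ y≢b)

    b≺b₁ : f ≢ a₁ → b ≺⟨ pA f ⟩ b₁
    b≺b₁ f≢a₁ with b-best b₁ (b₁-candidate inv f≢a₁)
    ... | inj₁ b≺b₁ = b≺b₁
    ... | inj₂ b≡b₁ = ⊥-elim (b≢b₁ b≡b₁)

    b₁-undesired′ : ∀ a → a ≢ h → a ≢ a₁ → μ′ ⟨$⟩ʳ a ≺⟨ pA a ⟩ b₁
    b₁-undesired′ a a≢h a≢a₁ with a ≟ f
    ... | yes refl = subst (_≺⟨ pA f ⟩ b₁) (sym μ′-f) (b≺b₁ a≢a₁)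
    ... | no a≢f = subst (_≺⟨ pA a ⟩ b₁) (sym (μ′-other a≢f a≢h)) (b₁-undesired a a≢f a≢a₁)

    f-no-envy′ : ∀ y → y ≢ b₁ → y ≺⟨ pA f ⟩ b → μ ⟨$⟩ˡ y ≺⟨ pB y ⟩ f
    f-no-envy′ y y≢b₁ y≺b with Pref.≺-or-≽ (pA f) c y
    ... | inj₂ y≼c = f-rejected y y≢b₁ y≼c
    ... | inj₁ c≺y with Pref.≮⇒≽ (pB y) f⊀μy
      where
      f⊀μy : ¬ f ≺⟨ pB y ⟩ μ ⟨$⟩ˡ y
      f⊀μy f≺μy = Pref.≺-≼-asym (pA f) y≺b (b-best y (c≺y , inj₂ (y≢b₁ , f≺μy)))
    ...   | inj₁ μy≺f = μy≺f
    ...   | inj₂ μy≡f = ⊥-elim (y≢b₁ (trans (sym (ˡ⇒ʳ μ μy≡f)) f↦b₁))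

    no-envy′ : ∀ a y → a ≢ h → y ≢ b₁ →
               y ≺⟨ pA a ⟩ μ′ ⟨$⟩ʳ a → μ′ ⟨$⟩ˡ y ≺⟨ pB y ⟩ a
    no-envy′ a y a≢h y≢b₁ y≺μ′a with a ≟ f
    ... | yes refl = subst (_≺⟨ pB y ⟩ f) (sym (μ′⁻¹-other (Pref.≺⇒≢ (pA f) y≺b) y≢b₁))
                       (f-no-envy′ y y≢b₁ y≺b)
      where
      y≺b : y ≺⟨ pA f ⟩ b
      y≺b = subst (y ≺⟨ pA f ⟩_) μ′-f y≺μ′a
    ... | no a≢f with y ≟ b
    ...   | yes refl = subst (_≺⟨ pB b ⟩ a) (sym μ′⁻¹-b)
                         (Pref.≺-trans (pB b) f≺h (no-envy a b a≢f b≢b₁ y≺μa))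
      where
      y≺μa : b ≺⟨ pA a ⟩ μ ⟨$⟩ʳ a
      y≺μa = subst (b ≺⟨ pA a ⟩_) (μ′-other a≢f a≢h) y≺μ′a
    ...   | no y≢b = subst (_≺⟨ pB y ⟩ a) (sym (μ′⁻¹-other y≢b y≢b₁))
                       (no-envy a y a≢f y≢b₁ y≺μa)
      where
      y≺μa : y ≺⟨ pA a ⟩ μ ⟨$⟩ʳ a
      y≺μa = subst (y ≺⟨ pA a ⟩_) (μ′-other a≢f a≢h) y≺μ′a

    h-rejected′ : ∀ y → y ≢ b₁ → y ≼⟨ pA h ⟩ b → μ′ ⟨$⟩ˡ y ≺⟨ pB y ⟩ h
    h-rejected′ y y≢b₁ (inj₂ refl) = subst (_≺⟨ pB b ⟩ h) (sym μ′⁻¹-b) f≺h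
    h-rejected′ y y≢b₁ (inj₁ y≺b) =
      subst (_≺⟨ pB y ⟩ h) (sym (μ′⁻¹-other (Pref.≺⇒≢ (pA h) y≺b) y≢b₁))
        (no-envy h y h≢f y≢b₁ (subst (y ≺⟨ pA h ⟩_) (sym μh) y≺b))

    a₁-above-b₂′ : h ≢ a₁ → μ′ ⟨$⟩ʳ a₁ ≼⟨ pA a₁ ⟩ b₂
    a₁-above-b₂′ h≢a₁ with f ≟ a₁
    ... | yes refl = subst (_≼⟨ pA f ⟩ b₂) (sym μ′-f) (b-best b₂ (b₂-candidate inv refl))
    ... | no f≢a₁ = subst (_≼⟨ pA a₁ ⟩ b₂) (sym (μ′-other (f≢a₁ ∘ sym) (h≢a₁ ∘ sym)))
                      (a₁-above-b₂ f≢a₁)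

    b-above-b₂′ : h ≡ a₁ → b ≺⟨ pA a₁ ⟩ b₂
    b-above-b₂′ h≡a₁ with subst (λ a → μ ⟨$⟩ʳ a ≼⟨ pA a₁ ⟩ b₂) (sym h≡a₁) (a₁-above-b₂ f≢a₁)
      where
      f≢a₁ : f ≢ a₁
      f≢a₁ f≡a₁ = h≢f (trans h≡a₁ (sym f≡a₁))
    ... | inj₁ μh≺b₂ = subst (_≺⟨ pA a₁ ⟩ b₂) μh μh≺b₂
    ... | inj₂ μh≡b₂ =
      ⊥-elim (Pref.≺-asym (pB b₂) a₁≺f (subst (f ≺⟨ pB b₂ ⟩_) h′≡a₁ f≺h′))
      where
      b≡b₂ : b ≡ b₂
      b≡b₂ = trans (sym μh) μh≡b₂
      f≺h′ : f ≺⟨ pB b₂ ⟩ μ ⟨$⟩ˡ b₂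
      f≺h′ = subst (λ y → f ≺⟨ pB y ⟩ μ ⟨$⟩ˡ y) b≡b₂ f≺h
      h′≡a₁ : μ ⟨$⟩ˡ b₂ ≡ a₁
      h′≡a₁ = trans (cong (μ ⟨$⟩ˡ_) (sym b≡b₂)) h≡a₁
      a₁≺f : a₁ ≺⟨ pB b₂ ⟩ f
      a₁≺f = a₁-first f λ f≡a₁ → h≢f (trans h≡a₁ (sym f≡a₁))

    invariant′ : Invariant μ′ h b
    invariant′ = record
      { f↦b₁ = μ′-h
      ; b₁-undesired = b₁-undesired′
      ; c≺b₁ = λ h≢a₁ → subst (_≺⟨ pA h ⟩ b₁) μh (b₁-undesired h h≢f h≢a₁)
      ; no-envy = no-envy′
      ; f-rejected = h-rejected′
      ; a₁-above-b₂ = a₁-above-b₂′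
      ; c-above-b₂ = b-above-b₂′
      }

    position-unchanged : ∀ a → a ≢ f → position μ′ h b a ≡ position μ f c a
    position-unchanged a a≢f = by-cases (a ≟ h)
      where
      open ≡-Reasoning
      by-cases : Dec (a ≡ h) → position μ′ h b a ≡ position μ f c a
      by-cases (yes a≡h) = begin
        position μ′ h b a  ≡⟨ cong (position μ′ h b) a≡h ⟩
        position μ′ h b h  ≡⟨ position-free μ′ h b ⟩
        b                  ≡⟨ μh ⟨
        μ ⟨$⟩ʳ h           ≡⟨ cong (μ ⟨$⟩ʳ_) a≡h ⟨
        μ ⟨$⟩ʳ a           ≡⟨ position-other μ f c a≢f ⟨
        position μ f c a   ∎
      by-cases (no a≢h) = begin
        position μ′ h b a  ≡⟨ position-other μ′ h b a≢h ⟩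
        μ′ ⟨$⟩ʳ a          ≡⟨ μ′-other a≢f a≢h ⟩
        μ ⟨$⟩ʳ a           ≡⟨ position-other μ f c a≢f ⟨
        position μ f c a   ∎

    potential-increases : potential μ f c < potential μ′ h b
    potential-increases = sum-map-mono-< _ _ rank≤ (allFin n) (∈-allFin f) f-moves-down
      where
      rank-before rank-after : Fin n → ℕ
      rank-before a = Pref.rank (pA a) (position μ f c a)
      rank-after a = Pref.rank (pA a) (position μ′ h b a)

      f-moves-down : rank-before f < rank-after f
      f-moves-down = subst₂ (λ x y → Pref.rank (pA f) x < Pref.rank (pA f) y)
        (sym (position-free μ f c)) (sym (trans (position-other μ′ h b (h≢f ∘ sym)) μ′-f))
        (rank-mono (pA f) c≺b)

      rank≤ : ∀ a → rank-before a ≤ rank-after a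
      rank≤ a = by-cases (a ≟ f)
        where
        by-cases : Dec (a ≡ f) → rank-before a ≤ rank-after a
        by-cases (yes refl) = ℕ.<⇒≤ f-moves-down
        by-cases (no a≢f) = ℕ.≤-reflexive (cong (Pref.rank (pA a)) (sym (position-unchanged a a≢f)))

  StableAvoiding : Set
  StableAvoiding = ∃ λ M′ → Stable pA pB M′ × M′ ⟨$⟩ˡ b₁ ≢ a₁

  run : ∀ μ f c → Invariant μ f c → Acc _<_ (n * n ∸ potential μ f c) → StableAvoiding
  run μ f c inv (acc smaller) with Pref.minimum (pA f) (candidate? μ f c)
  ... | inj₁ none = ⊥-elim (none _ (proj₂ (candidate-exists inv)))
  ... | inj₂ (_ , (_ , inj₁ (refl , f≢a₁)) , b₁-best) =
    μ , stable-if-b₁-best inv b₁-best ,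
    λ μb₁≡a₁ → f≢a₁ (trans (sym (ʳ⇒ˡ μ (Invariant.f↦b₁ inv))) μb₁≡a₁)
  ... | inj₂ (b , (c≺b , inj₂ (b≢b₁ , f≺h)) , b-best) =
    run μ′ h b invariant′ (smaller (ℕ.∸-monoʳ-< potential-increases (potential≤n² μ′ h b)))
    where open Step inv b≢b₁ c≺b f≺h b-best

  initial : Invariant M a₁ b₁
  initial = record
    { f↦b₁ = M-a₁
    ; b₁-undesired = λ a _ a≢a₁ → b₁-undesired-in-M a a≢a₁
    ; c≺b₁ = λ a₁≢a₁ → ⊥-elim (a₁≢a₁ refl)
    ; no-envy = λ _ _ _ _ → stable⇒prefers-partner pA pB M M-stable
    ; f-rejected = λ { b _ (inj₁ b≺b₁) → stable⇒prefers-partner pA pB M M-stable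
                                            (subst (b ≺⟨ pA a₁ ⟩_) (sym M-a₁) b≺b₁)
                     ; b b≢b₁ (inj₂ b≡b₁) → ⊥-elim (b≢b₁ b≡b₁) }
    ; a₁-above-b₂ = λ a₁≢a₁ → ⊥-elim (a₁≢a₁ refl)
    ; c-above-b₂ = λ _ → b₁≺b₂
    }

  stable-avoiding : StableAvoiding
  stable-avoiding = run M a₁ b₁ initial (<-wellFounded _)

  ¬BOptimal : ¬ BOptimal pA pB M
  ¬BOptimal optimal with M′ , M′-stable , M′b₁≢a₁ ← stable-avoiding
                    with optimal M′ M′-stable b₁
  ... | inj₁ a₁≡M′b₁ = M′b₁≢a₁ (sym a₁≡M′b₁)
  ... | inj₂ a₁≺M′b₁ = a₁-unwanted _ a₁≺M′b₁

unqueried-unique : ∀ {n} (pA pB : Profile n) (M : Matching n) (Q : List (Query n)) →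
  Verifies pA pB M Q → ∀ {b₁ b₂} → b₁ ∉ queried Q → b₂ ∉ queried Q → b₁ ≡ b₂
unqueried-unique {n} pA pB M Q verifies {b₁} {b₂} b₁∉Q b₂∉Q with b₁ ≟ b₂
... | yes b₁≡b₂ = b₁≡b₂
... | no b₁≢b₂ =
  ⊥-elim (BreakMarriage.¬BOptimal pA pB′ M stable b₁ b₂ b₁≢b₂ a₁-last a₁-first optimal)
  where
  a₁ : Fin n
  a₁ = M ⟨$⟩ˡ b₁

  pB₁ pB′ : Profile n
  pB₁ = pB [ b₁ ≔ putLast a₁ ]
  pB′ = pB₁ [ b₂ ≔ putFirst a₁ ]

  pB′-agrees : ∀ b → b ∈ queried Q → pB′ b ≡ pB b
  pB′-agrees b b∈Q = trans (update-≢ pB₁ b₂ (putFirst a₁) b λ { refl → b₂∉Q b∈Q })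
                           (update-≢ pB b₁ (putLast a₁) b λ { refl → b₁∉Q b∈Q })

  stable : Stable pA pB′ M
  stable = proj₁ (verifies pB′ (agree⇒consistent Q pB′-agrees))

  optimal : BOptimal pA pB′ M
  optimal = proj₂ (verifies pB′ (agree⇒consistent Q pB′-agrees))

  pB′-b₁ : pB′ b₁ ≡ putLast a₁
  pB′-b₁ = trans (update-≢ pB₁ b₂ (putFirst a₁) b₁ b₁≢b₂) (update-≡ pB b₁ (putLast a₁))

  a₁-last : ∀ a → a ≢ a₁ → a ≺⟨ pB′ b₁ ⟩ a₁
  a₁-last a a≢a₁ = subst (λ o → a ≺⟨ o ⟩ a₁) (sym pB′-b₁) (putLast-last a₁ a a≢a₁)

  a₁-first : ∀ a → a ≢ a₁ → a₁ ≺⟨ pB′ b₂ ⟩ a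
  a₁-first a a≢a₁ = subst (λ o → a₁ ≺⟨ o ⟩ a) (sym (update-≡ pB₁ b₂ (putFirst a₁)))
                      (putFirst-first a₁ a a≢a₁)

lemma8 : (n : ℕ) (pA pB : Profile n) (M : Matching n) →
    Stable pA pB M → BOptimal pA pB M →
    (Q : List (Query n)) → Verifies pA pB M Q →
    n ∸ 1 ≤ length Q
lemma8 n pA pB M _ _ Q verifies =
  subst (n ∸ 1 ≤_) (length-map proj₁ Q)
    (length-of-all-but-one (queried Q) (unqueried-unique pA pB M Q verifies))
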